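{- Let $W=(w_{ij})_{1\le i,j\le n}$ be an almost-triangular scalar matrix ($w_{ij}=0$ for $i>j+1$), and let $H'(W,S)$ be the row-ordered determinant of the $n\times n$ matrix whose $(i,j)$ entry is $w_{ij}S_{j-i+1}$ (with $S_0=1$, and entry $0$ when $i>j+1$). For a composition $I=(i_1,\dots,i_r)$ of $n$, let $W_I$ be the product of the determinants of the diagonal blocks of $W$ formed by the first $i_1$ rows and columns, then the next $i_2$ rows and columns, and so on. Then $$H'(W,S)=\sum_{I\vDash n}W_I\,R_I.$$
   Context: $S_k$ are the noncommutative complete symmetric functions and $R_I$ the ribbon basis of noncommutative symmetric functions. The row-ordered determinant of a matrix $A$ with noncommuting entries is $\mathrm{rdet}(A)=\sum_{\sigma\in\mathfrak S_n}\varepsilon(\sigma)a_{1\sigma(1)}\cdots a_{n\sigma(n)}$. -}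

module Defs where

open import Level using (Level)
open import Algebra.Bundles using (CommutativeRing)
open import Data.Nat as ℕ using (ℕ; zero; suc; _<_; _≤?_)
open import Data.Nat.Properties using ()
open import Data.Fin using (Fin; toℕ; _>_)
open import Data.Fin.Properties using (_<?_)
open import Data.Bool using (Bool; true; false; not; if_then_else_)
open import Data.List using (List; []; _∷_; map; concatMap; foldr; length; allFin; zip; _++_)
open import Data.Product using (_×_; _,_)
open import Relation.Nullary using (does; yes; no)
open import Data.Fin using (fromℕ<)

insertions : {A : Set} → A → List A → List (List A)
insertions x []       = (x ∷ []) ∷ []
insertions x (y ∷ ys) = (x ∷ y ∷ ys) ∷ map (y ∷_) (insertions x ys)

perms : {A : Set} → List A → List (List A)
perms []       = [] ∷ []
perms (x ∷ xs) = concatMap (insertions x) (perms xs)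

countGreater : {n : ℕ} → Fin n → List (Fin n) → Bool
countGreater x []       = false
countGreater x (y ∷ ys) = if does (y <? x) then not (countGreater x ys) else countGreater x ys

xor : Bool → Bool → Bool
xor false b = b
xor true  b = not b

oddInversions : {n : ℕ} → List (Fin n) → Bool
oddInversions []       = false
oddInversions (x ∷ xs) = xor (countGreater x xs) (oddInversions xs)

splits : {A : Set} → List A → List (List A × List A)
splits []       = ([] , []) ∷ []
splits (x ∷ xs) = ([] , x ∷ xs) ∷ map (λ { (J , K) → (x ∷ J , K) }) (splits xs)

incHead : List ℕ → List ℕ
incHead []       = []
incHead (a ∷ as) = suc a ∷ as

compositions : ℕ → List (List ℕ)
compositions zero          = [] ∷ []
compositions (suc zero)    = (1 ∷ []) ∷ []
compositions (suc (suc n)) =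
  map (1 ∷_) (compositions (suc n)) ++ map incHead (compositions (suc n))

-- coarsenings J ≽ I of a composition I (J obtained by adding together
-- blocks of consecutive parts of I), paired with the parity of ℓ(I) - ℓ(J)
-- (true = odd)
coarsenings : List ℕ → List (List ℕ × Bool)
coarsenings []       = ([] , false) ∷ []
coarsenings (a ∷ as) = concatMap step (coarsenings as)
  where
  step : List ℕ × Bool → List (List ℕ × Bool)
  step ([]      , p) = (a ∷ [] , p) ∷ []
  step ((b ∷ J) , p) = (a ∷ b ∷ J , p) ∷ (a ℕ.+ b ∷ J , not p) ∷ []

-- Row-ordered determinant over an arbitrary (possibly noncommutative)
-- ring given by its raw operations:
--   rdet A = Σ_σ ε(σ) a_{1σ(1)} a_{2σ(2)} ⋯ a_{nσ(n)}   (products in row order)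

rdet : {a : Level} {X : Set a} →
       (_+_ _*_ : X → X → X) (neg : X → X) (zero# one# : X) →
       (n : ℕ) → (Fin n → Fin n → X) → X
rdet {X = X} _+_ _*_ neg zero# one# n A =
  foldr (λ σ acc → term σ + acc) zero# (perms (allFin n))
  where
  prod : List (Fin n × Fin n) → X
  prod = foldr (λ { (i , j) acc → A i j * acc }) one#
  term : List (Fin n) → X
  term σ = if oddInversions σ then neg (prod (zip (allFin n) σ))
                              else prod (zip (allFin n) σ)

-- Sym is the free associative R-algebra on S₁, S₂, …; we represent an
-- element by its coefficient function in the basis S^J (J a word of
-- positive integers; coefficients on words containing 0 are never
-- produced).  Multiplication is concatenation-convolution, so that
-- S^J · S^K = S^(J++K).

module NSymDefs {c ℓ : Level} (R : CommutativeRing c ℓ) where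
  open CommutativeRing R renaming (Carrier to K)

  NSym : Set c
  NSym = List ℕ → K

  _≋_ : NSym → NSym → Set ℓ
  f ≋ g = (J : List ℕ) → f J ≈ g J

  sumK : List K → K
  sumK = foldr _+_ 0#

  _⊕_ : NSym → NSym → NSym
  (f ⊕ g) J = f J + g J

  _⊗_ : NSym → NSym → NSym
  (f ⊗ g) J = sumK (map (λ { (J₁ , J₂) → f J₁ * g J₂ }) (splits J))

  ⊖_ : NSym → NSym
  (⊖ f) J = - (f J)

  𝟘 : NSym
  𝟘 _ = 0#

  _·_ : K → NSym → NSym
  (k · f) J = k * f J

  𝟙 : NSym
  𝟙 []      = 1#
  𝟙 (_ ∷ _) = 0#

  S : ℕ → NSym
  S zero    = 𝟙
  S (suc k) []          = 0#
  S (suc k) (a ∷ [])    = if does (suc k ℕ.≟ a) then 1# else 0#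
  S (suc k) (a ∷ _ ∷ _) = 0#

  Sprod : List ℕ → NSym
  Sprod = foldr (λ j acc → S j ⊗ acc) 𝟙

  sumN : List NSym → NSym
  sumN = foldr _⊕_ 𝟘

  Rib : List ℕ → NSym
  Rib I = sumN (map (λ { (J , odd) → if odd then ⊖ Sprod J else Sprod J })
                    (coarsenings I))

  rdetN : (n : ℕ) → (Fin n → Fin n → NSym) → NSym
  rdetN = rdet _⊕_ _⊗_ ⊖_ 𝟘 𝟙

  detK : (n : ℕ) → (Fin n → Fin n → K) → K
  detK = rdet _+_ _*_ -_ 0# 1#

  AlmostTriangular : (n : ℕ) → (Fin n → Fin n → K) → Set ℓ
  AlmostTriangular n W = (i j : Fin n) → suc (toℕ j) < toℕ i → W i j ≈ 0#

  H'entry : (n : ℕ) → (Fin n → Fin n → K) → Fin n → Fin n → NSym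
  H'entry n W i j with toℕ i ≤? suc (toℕ j)
  ... | yes _ = W i j · S (suc (toℕ j) ℕ.∸ toℕ i)
  ... | no  _ = 𝟘

  H' : (n : ℕ) → (Fin n → Fin n → K) → NSym
  H' n W = rdetN n (H'entry n W)

  extend : (n : ℕ) → (Fin n → Fin n → K) → ℕ → ℕ → K
  extend n W i j with i ℕ.<? n | j ℕ.<? n
  ... | yes p | yes q = W (fromℕ< p) (fromℕ< q)
  ... | _     | _     = 0#

  blockProd : (ℕ → ℕ → K) → ℕ → List ℕ → K
  blockProd V o []       = 1#
  blockProd V o (k ∷ I)  =
    detK k (λ a b → V (o ℕ.+ toℕ a) (o ℕ.+ toℕ b)) * blockProd V (o ℕ.+ k) I

  W_ : (n : ℕ) → (Fin n → Fin n → K) → List ℕ → K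
  W_ n W I = blockProd (extend n W) 0 I

-- Let G_m(u, V) be the row-ordered determinant of the matrix (v_ij S_{j-i+1}) whose first row is
-- replaced by (u_j S_{m+j}), so that H'(W, S) = G_0(w_1, W).  As V is almost triangular, the first
-- column has only two nonzero entries, u_1 S_{m+1} and the scalar v_21, and expanding along it gives
--   G_m(u, V) = u_1 S_{m+1} G_0(v, V') - G_{m+1}(u', V'),
-- where V' is V without its first row and column, v_j = v_{2,j+1} and u'_j = v_21 u_{j+1}.
-- The right-hand side  Σ_I c_I(u, V) R^(m)_I,  where c_I is W_I with the first row of its first
-- block replaced by u and R^(m)_I is R_I with the first part of every S^J raised by m, obeys the
-- same recursion: the compositions of n+1 are 1·I and (i_1+1, i_2, ...) for I ⊨ n, the ribbons
-- satisfy R^(m)_{1I} = S_{m+1} R_I - R^(m+1)_I and R^(m)_{(i+1)I} = R^(m+1)_{iI}, and the scalar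
-- determinant of the first block expands along its first column in the same way.

module Submission where

open import Defs
open import Level using (Level)
open import Algebra.Bundles using (AbelianGroup; CommutativeRing; NonAssociativeRing; Ring)
import Algebra.Construct.Pointwise as Pointwise
open import Data.Bool using (Bool; true; false; not; if_then_else_)
open import Data.Bool.Properties using (not-involutive)
open import Data.Empty using (⊥-elim)
open import Data.Fin using (Fin; zero; suc; toℕ; fromℕ<)
open import Data.Fin.Properties using (toℕ<n; fromℕ<-toℕ; toℕ-fromℕ<)
open import Data.List using (List; []; _∷_; map; concatMap; foldr; length; allFin; tabulate; zip; _++_)
open import Data.List.Properties
  using ( map-tabulate; map-∘; concatMap-map; concatMap-cong; map-concatMap; foldr-map; foldr-cong
        ; length-map; length-tabulate)
open import Data.List.Relation.Unary.All as All using (All; []; _∷_)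
import Data.List.Relation.Unary.All.Properties as All
open import Data.Nat as ℕ using (ℕ; zero; suc; _∸_; _<_; z≤n; s≤s)
open import Data.Nat.Properties using (+-suc; ≰⇒>)
open import Data.Product using (_×_; _,_; proj₁; map₁)
open import Function using (_∘_; id)
open import Relation.Binary.PropositionalEquality as ≡ using (_≡_; cong; cong₂)
open import Relation.Nullary using (yes; no)

private
  variable
    A B : Set

length-insertions : (x : A) (ys : List A) →
                    All (λ w → length w ≡ suc (length ys)) (insertions x ys)
length-insertions x []       = ≡.refl ∷ []
length-insertions x (y ∷ ys) = ≡.refl ∷ All.map⁺ (All.map (cong suc) (length-insertions x ys))

length-perms : (xs : List A) → All (λ σ → length σ ≡ length xs) (perms xs)
length-perms []       = ≡.refl ∷ []
length-perms (x ∷ xs) = All.concat⁺ (All.map⁺ (All.map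
  (λ {σ} eq → All.map (λ eq′ → ≡.trans eq′ (cong suc eq)) (length-insertions x σ))
  (length-perms xs)))

insertions-map : (f : A → B) (x : A) (ys : List A) →
                 insertions (f x) (map f ys) ≡ map (map f) (insertions x ys)
insertions-map f x []       = ≡.refl
insertions-map f x (y ∷ ys) = cong ((f x ∷ f y ∷ map f ys) ∷_) (begin
  map (f y ∷_) (insertions (f x) (map f ys))   ≡⟨ cong (map (f y ∷_)) (insertions-map f x ys) ⟩
  map (f y ∷_) (map (map f) (insertions x ys)) ≡⟨ ≡.sym (map-∘ (insertions x ys)) ⟩
  map (map f ∘ (y ∷_)) (insertions x ys)       ≡⟨ map-∘ (insertions x ys) ⟩
  map (map f) (map (y ∷_) (insertions x ys))   ∎)
  where open ≡.≡-Reasoning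

perms-map : (f : A → B) (xs : List A) → perms (map f xs) ≡ map (map f) (perms xs)
perms-map f []       = ≡.refl
perms-map f (x ∷ xs) = begin
  concatMap (insertions (f x)) (perms (map f xs))
    ≡⟨ cong (concatMap (insertions (f x))) (perms-map f xs) ⟩
  concatMap (insertions (f x)) (map (map f) (perms xs))
    ≡⟨ concatMap-map (insertions (f x)) (map f) (perms xs) ⟩
  concatMap (insertions (f x) ∘ map f) (perms xs)
    ≡⟨ concatMap-cong (insertions-map f x) (perms xs) ⟩
  concatMap (map (map f) ∘ insertions x) (perms xs)
    ≡⟨ ≡.sym (map-concatMap (map f) (insertions x) (perms xs)) ⟩
  map (map f) (concatMap (insertions x) (perms xs)) ∎
  where open ≡.≡-Reasoning

laterInsertions : A → List A → List (List A)
laterInsertions x []       = []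
laterInsertions x (y ∷ ys) = map (y ∷_) (insertions x ys)

insertions-≡-∷-laterInsertions : (x : A) (ys : List A) →
                                 insertions x ys ≡ (x ∷ ys) ∷ laterInsertions x ys
insertions-≡-∷-laterInsertions x []       = ≡.refl
insertions-≡-∷-laterInsertions x (y ∷ ys) = ≡.refl

allFin-suc : ∀ n → allFin (suc n) ≡ zero ∷ map suc (allFin n)
allFin-suc n = cong (zero ∷_) (≡.sym (map-tabulate id suc))

countGreater-zero : ∀ {n} (ys : List (Fin (suc n))) → countGreater zero ys ≡ false
countGreater-zero []       = ≡.refl
countGreater-zero (y ∷ ys) = countGreater-zero ys

countGreater-suc : ∀ {n} (x : Fin n) ys → countGreater (suc x) (map suc ys) ≡ countGreater x ys
countGreater-suc x []       = ≡.refl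
countGreater-suc x (y ∷ ys) rewrite countGreater-suc x ys = ≡.refl

oddInversions-map-suc : ∀ {n} (ys : List (Fin n)) → oddInversions (map suc ys) ≡ oddInversions ys
oddInversions-map-suc []       = ≡.refl
oddInversions-map-suc (y ∷ ys) rewrite countGreater-suc y ys | oddInversions-map-suc ys = ≡.refl

oddInversions-zero∷ : ∀ {n} (τ : List (Fin n)) → oddInversions (zero ∷ map suc τ) ≡ oddInversions τ
oddInversions-zero∷ τ rewrite countGreater-zero (map suc τ) = oddInversions-map-suc τ

xor-not : ∀ a b → xor (not a) b ≡ not (xor a b)
xor-not true  b = ≡.sym (not-involutive b)
xor-not false b = ≡.refl

oddInversions-suc∷zero∷ : ∀ {n} (t : Fin n) τ →
                          oddInversions (suc t ∷ zero ∷ map suc τ) ≡ not (oddInversions (t ∷ τ))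
oddInversions-suc∷zero∷ t τ
  rewrite countGreater-suc t τ | countGreater-zero (map suc τ) | oddInversions-map-suc τ =
  xor-not (countGreater t τ) (oddInversions τ)

data NonEmpty {A : Set} : List A → Set where
  nonEmpty : ∀ {x xs} → NonEmpty (x ∷ xs)

data PositiveHead : List ℕ → Set where
  positiveHead : ∀ {i I} → PositiveHead (suc i ∷ I)

compositions-positiveHead : ∀ k → All PositiveHead (compositions (suc k))
compositions-positiveHead zero    = positiveHead ∷ []
compositions-positiveHead (suc k) = All.++⁺
  (All.map⁺ (All.universal (λ _ → positiveHead) (compositions (suc k))))
  (All.map⁺ (All.map (λ { positiveHead → positiveHead }) (compositions-positiveHead k)))

module _ {a} {X : Set a} where

  shift : (ℕ → ℕ → X) → ℕ → ℕ → X
  shift M i j = M (suc i) (suc j)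

  withFirstRow : (ℕ → X) → (ℕ → ℕ → X) → ℕ → ℕ → X
  withFirstRow r M zero    j = r j
  withFirstRow r M (suc i) j = M (suc i) j

module RowDeterminant {c ℓ} (R : NonAssociativeRing c ℓ) where
  open NonAssociativeRing R renaming (Carrier to X) hiding (zero)
  open import Algebra.Properties.AbelianGroup +-abelianGroup using (⁻¹-∙-comm)
  open import Algebra.Properties.Group +-group using (⁻¹-involutive; ε⁻¹≈ε; inverseʳ-unique)
  open import Algebra.Properties.CommutativeSemigroup (AbelianGroup.commutativeSemigroup +-abelianGroup)
    using (interchange)
  open import Relation.Binary.Reasoning.Setoid setoid

  -‿distribʳ-* : ∀ x y → - (x * y) ≈ x * - y
  -‿distribʳ-* x y = sym (inverseʳ-unique (x * y) (x * - y) (begin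
    x * y + x * - y ≈⟨ sym (distribˡ x y (- y)) ⟩
    x * (y - y)     ≈⟨ *-congˡ (-‿inverseʳ y) ⟩
    x * 0#          ≈⟨ zeroʳ x ⟩
    0#              ∎))

  ∑ : (A → X) → List A → X
  ∑ f xs = foldr _+_ 0# (map f xs)

  ∑-congᴬ : {f g : A → X} {xs : List A} → All (λ x → f x ≈ g x) xs → ∑ f xs ≈ ∑ g xs
  ∑-congᴬ []         = refl
  ∑-congᴬ (eq ∷ eqs) = +-cong eq (∑-congᴬ eqs)

  ∑-cong : {f g : A → X} → (∀ x → f x ≈ g x) → ∀ xs → ∑ f xs ≈ ∑ g xs
  ∑-cong eq xs = ∑-congᴬ (All.universal eq xs)

  ∑-zeroᴬ : {f : A → X} {xs : List A} → All (λ x → f x ≈ 0#) xs → ∑ f xs ≈ 0#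
  ∑-zeroᴬ []         = refl
  ∑-zeroᴬ (eq ∷ eqs) = trans (+-cong eq (∑-zeroᴬ eqs)) (+-identityʳ 0#)

  ∑-map : (f : B → X) (g : A → B) (xs : List A) → ∑ f (map g xs) ≡ ∑ (f ∘ g) xs
  ∑-map f g []       = ≡.refl
  ∑-map f g (x ∷ xs) = cong (f (g x) +_) (∑-map f g xs)

  ∑-++ : (f : A → X) (xs ys : List A) → ∑ f (xs ++ ys) ≈ ∑ f xs + ∑ f ys
  ∑-++ f []       ys = sym (+-identityˡ _)
  ∑-++ f (x ∷ xs) ys = trans (+-congˡ (∑-++ f xs ys)) (sym (+-assoc _ _ _))

  ∑-concatMap : (f : B → X) (g : A → List B) (xs : List A) →
                ∑ f (concatMap g xs) ≈ ∑ (λ x → ∑ f (g x)) xs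
  ∑-concatMap f g []       = refl
  ∑-concatMap f g (x ∷ xs) = trans (∑-++ f (g x) (concatMap g xs)) (+-congˡ (∑-concatMap f g xs))

  ∑-+ : (f g : A → X) (xs : List A) → ∑ (λ x → f x + g x) xs ≈ ∑ f xs + ∑ g xs
  ∑-+ f g []       = sym (+-identityʳ 0#)
  ∑-+ f g (x ∷ xs) = trans (+-congˡ (∑-+ f g xs)) (interchange _ _ _ _)

  ∑-neg : (f : A → X) (xs : List A) → ∑ (λ x → - f x) xs ≈ - ∑ f xs
  ∑-neg f []       = sym ε⁻¹≈ε
  ∑-neg f (x ∷ xs) = trans (+-congˡ (∑-neg f xs)) (⁻¹-∙-comm _ _)

  ∑-- : (f g : A → X) (xs : List A) → ∑ (λ x → f x - g x) xs ≈ ∑ f xs - ∑ g xs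
  ∑-- f g xs = trans (∑-+ f (λ x → - g x) xs) (+-congˡ (∑-neg g xs))

  *-∑ : (x : X) (f : A → X) (xs : List A) → x * ∑ f xs ≈ ∑ (λ y → x * f y) xs
  *-∑ x f []       = zeroʳ x
  *-∑ x f (y ∷ ys) = trans (distribˡ _ _ _) (+-congˡ (*-∑ x f ys))

  signed : Bool → X → X
  signed true  x = - x
  signed false x = x

  signed-cong : ∀ b {x y} → x ≈ y → signed b x ≈ signed b y
  signed-cong true  eq = -‿cong eq
  signed-cong false eq = eq

  signed-*ʳ : ∀ b x y → signed b (x * y) ≈ x * signed b y
  signed-*ʳ true  x y = -‿distribʳ-* x y
  signed-*ʳ false x y = refl

  signed-not : ∀ b x → signed (not b) x ≈ - signed b x
  signed-not true  x = sym (⁻¹-involutive x)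
  signed-not false x = refl

  signed-zero : ∀ b {x} → x ≈ 0# → signed b x ≈ 0#
  signed-zero true  eq = trans (-‿cong eq) ε⁻¹≈ε
  signed-zero false eq = eq

  entryProduct : (A → B → X) → List A → List B → X
  entryProduct M (r ∷ rs) (c ∷ cs) = M r c * entryProduct M rs cs
  entryProduct M _        _        = 1#

  entryProduct-congᴬ : {M N : A → B → X} {rs : List A} → All (λ r → ∀ c → M r c ≈ N r c) rs →
                       ∀ cs → entryProduct M rs cs ≈ entryProduct N rs cs
  entryProduct-congᴬ (eq ∷ eqs) (c ∷ cs) = *-cong (eq c) (entryProduct-congᴬ eqs cs)
  entryProduct-congᴬ []         _        = refl
  entryProduct-congᴬ (_ ∷ _)    []       = refl

  entryProduct-cong : {M N : A → B → X} → (∀ r c → M r c ≈ N r c) →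
                      ∀ rs cs → entryProduct M rs cs ≈ entryProduct N rs cs
  entryProduct-cong eq rs = entryProduct-congᴬ (All.universal eq rs)

  entryProduct-map : ∀ {A′ B′} (M : A → B → X) (f : A′ → A) (g : B′ → B) rs cs →
                     entryProduct M (map f rs) (map g cs) ≡ entryProduct (λ r c → M (f r) (g c)) rs cs
  entryProduct-map M f g (r ∷ rs) (c ∷ cs) = cong (M (f r) (g c) *_) (entryProduct-map M f g rs cs)
  entryProduct-map M f g []       _        = ≡.refl
  entryProduct-map M f g (_ ∷ _)  []       = ≡.refl

  entryProduct-insertions : (M : A → B → X) (c : B) {rs : List A} {cs : List B} →
    All (λ r → M r c ≈ 0#) rs → length rs ≡ suc (length cs) →
    All (λ w → entryProduct M rs w ≈ 0#) (insertions c cs)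
  entryProduct-insertions M c {r ∷ []}     {[]}     (z ∷ _)  _  = trans (*-congʳ z) (zeroˡ _) ∷ []
  entryProduct-insertions M c {r ∷ rs}     {c′ ∷ cs} (z ∷ zs) eq =
    trans (*-congʳ z) (zeroˡ _) ∷
    All.map⁺ (All.map (λ p → trans (*-congˡ p) (zeroʳ _))
                      (entryProduct-insertions M c zs (cong ℕ.pred eq)))
  entryProduct-insertions M c {[]}         {_}      _        ()
  entryProduct-insertions M c {_ ∷ _ ∷ _}  {[]}     _        ()

  entryProduct-laterInsertions : (M : A → B → X) (c : B) (r : A) {rs : List A} {cs : List B} →
    All (λ r → M r c ≈ 0#) rs → length rs ≡ length cs →
    All (λ w → entryProduct M (r ∷ rs) w ≈ 0#) (laterInsertions c cs)
  entryProduct-laterInsertions M c r {cs = []}     zs eq = []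
  entryProduct-laterInsertions M c r {cs = _ ∷ cs} zs eq = All.map⁺
    (All.map (λ p → trans (*-congˡ p) (zeroʳ _)) (entryProduct-insertions M c zs eq))

  rdetTerm : ∀ {n} → (Fin n → Fin n → X) → List (Fin n) → X
  rdetTerm {n} M σ = signed (oddInversions σ) (entryProduct M (allFin n) σ)

  rdet-≡-∑ : ∀ n (M : Fin n → Fin n → X) →
             rdet _+_ _*_ -_ 0# 1# n M ≡ ∑ (rdetTerm M) (perms (allFin n))
  rdet-≡-∑ n M = ≡.trans
    (foldr-cong (λ σ acc → cong (_+ acc) (if-signed (oddInversions σ) (foldr-zip (allFin n) σ)))
                ≡.refl (perms (allFin n)))
    (≡.sym (foldr-map _+_ (rdetTerm M) 0# (perms (allFin n))))
    where
    if-signed : ∀ b {x y} → x ≡ y → (if b then - x else x) ≡ signed b y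
    if-signed true  ≡.refl = ≡.refl
    if-signed false ≡.refl = ≡.refl
    foldr-zip : ∀ rs cs → foldr (λ { (i , j) acc → M i j * acc }) 1# (zip rs cs) ≡ entryProduct M rs cs
    foldr-zip (r ∷ rs) (c ∷ cs) = cong (M r c *_) (foldr-zip rs cs)
    foldr-zip []       _        = ≡.refl
    foldr-zip (_ ∷ _)  []       = ≡.refl

  rdet-cong : ∀ n {M N : Fin n → Fin n → X} → (∀ i j → M i j ≈ N i j) →
              rdet _+_ _*_ -_ 0# 1# n M ≈ rdet _+_ _*_ -_ 0# 1# n N
  rdet-cong n {M} {N} eq = begin
    rdet _+_ _*_ -_ 0# 1# n M
      ≡⟨ rdet-≡-∑ n M ⟩
    ∑ (rdetTerm M) (perms (allFin n))
      ≈⟨ ∑-cong (λ σ → signed-cong (oddInversions σ) (entryProduct-cong eq (allFin n) σ))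
                (perms (allFin n)) ⟩
    ∑ (rdetTerm N) (perms (allFin n))
      ≡⟨ ≡.sym (rdet-≡-∑ n N) ⟩
    rdet _+_ _*_ -_ 0# 1# n N ∎

  det : ℕ → (ℕ → ℕ → X) → X
  det n M = rdet _+_ _*_ -_ 0# 1# n (λ a b → M (toℕ a) (toℕ b))

  det-cong : ∀ n {M N : ℕ → ℕ → X} → (∀ i j → M i j ≈ N i j) → det n M ≈ det n N
  det-cong n eq = rdet-cong n (λ a b → eq (toℕ a) (toℕ b))

  -- φ moves the entry M 1 0 to the left past the first factor of a product.
  module FirstColumnExpansion
    (k : ℕ) (M : ℕ → ℕ → X) (φ : X → X)
    (vanish : ∀ i → M (suc (suc i)) 0 ≈ 0#)
    (absorb : ∀ x y → x * (M 1 0 * y) ≈ φ x * y)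
    where

    M̂ : Fin (suc (suc k)) → Fin (suc (suc k)) → X
    M̂ a b = M (toℕ a) (toℕ b)

    minor folded : Fin (suc k) → Fin (suc k) → X
    minor  a b = shift M (toℕ a) (toℕ b)
    folded a b = withFirstRow (φ ∘ M 0 ∘ suc) (shift M) (toℕ a) (toℕ b)

    rows : List (Fin (suc k))
    rows = allFin (suc k)

    lower-rows : List (Fin (suc (suc k)))
    lower-rows = map suc (tabulate {n = k} suc)

    lower-rows-vanish : All (λ r → M̂ r zero ≈ 0#) lower-rows
    lower-rows-vanish = All.map⁺ (All.tabulate⁺ (λ i → vanish (toℕ i)))

    rdetTerm′ : List (Fin (suc (suc k))) → X
    rdetTerm′ σ = signed (oddInversions σ) (entryProduct M̂ (zero ∷ map suc rows) σ)

    rdetTerm′-diagonal : ∀ τ → rdetTerm′ (zero ∷ map suc τ) ≈ M 0 0 * rdetTerm minor τ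
    rdetTerm′-diagonal τ = begin
      rdetTerm′ (zero ∷ map suc τ)
        ≡⟨ cong₂ (λ b p → signed b (M 0 0 * p))
                 (oddInversions-zero∷ τ) (entryProduct-map M̂ suc suc rows τ) ⟩
      signed (oddInversions τ) (M 0 0 * entryProduct minor rows τ)
        ≈⟨ signed-*ʳ (oddInversions τ) _ _ ⟩
      M 0 0 * rdetTerm minor τ ∎

    rdetTerm′-subdiagonal : ∀ t τ →
                            rdetTerm′ (suc t ∷ zero ∷ map suc τ) ≈ - rdetTerm folded (t ∷ τ)
    rdetTerm′-subdiagonal t τ = begin
      rdetTerm′ (suc t ∷ zero ∷ map suc τ)
        ≡⟨ cong₂ (λ b p → signed b (x * (M 1 0 * p)))
                 (oddInversions-suc∷zero∷ t τ) (entryProduct-map M̂ suc suc (tabulate suc) τ) ⟩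
      signed (not (oddInversions (t ∷ τ))) (x * (M 1 0 * entryProduct minor (tabulate suc) τ))
        ≈⟨ signed-not (oddInversions (t ∷ τ)) _ ⟩
      - signed (oddInversions (t ∷ τ)) (x * (M 1 0 * entryProduct minor (tabulate suc) τ))
        ≈⟨ -‿cong (signed-cong (oddInversions (t ∷ τ)) (trans (absorb _ _) (*-congˡ minor≈folded))) ⟩
      - rdetTerm folded (t ∷ τ) ∎
      where
      x = M̂ zero (suc t)
      minor≈folded : entryProduct minor (tabulate suc) τ ≈ entryProduct folded (tabulate suc) τ
      minor≈folded = entryProduct-congᴬ {M = minor} {N = folded} {rs = tabulate {n = k} suc}
                                        (All.tabulate⁺ (λ _ _ → refl)) τ

    rdetTerm′-later : ∀ t τ → length τ ≡ k →
                      ∑ rdetTerm′ (map (suc t ∷_) (laterInsertions zero (map suc τ))) ≈ 0#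
    rdetTerm′-later t τ len =
      trans (reflexive (∑-map rdetTerm′ (suc t ∷_) (laterInsertions zero (map suc τ))))
      (∑-zeroᴬ (All.map (λ {w} p → signed-zero (oddInversions (suc t ∷ w)) (trans (*-congˡ p) (zeroʳ _)))
        (entryProduct-laterInsertions M̂ zero (suc zero) {cs = map suc τ} lower-rows-vanish length-eq)))
      where
      length-eq : length lower-rows ≡ length (map suc τ)
      length-eq = ≡.trans (length-map suc (tabulate {n = k} suc))
                    (≡.trans (length-tabulate suc) (≡.trans (≡.sym len) (≡.sym (length-map suc τ))))

    insertions-∑ : ∀ τ → length τ ≡ length rows →
                   ∑ rdetTerm′ (insertions zero (map suc τ)) ≈ M 0 0 * rdetTerm minor τ - rdetTerm folded τ
    insertions-∑ (t ∷ τ) len = begin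
      rdetTerm′ (zero ∷ map suc (t ∷ τ)) + ∑ rdetTerm′ (map (suc t ∷_) (insertions zero (map suc τ)))
        ≡⟨ cong (λ ws → rdetTerm′ (zero ∷ map suc (t ∷ τ)) + ∑ rdetTerm′ (map (suc t ∷_) ws))
                (insertions-≡-∷-laterInsertions zero (map suc τ)) ⟩
      rdetTerm′ (zero ∷ map suc (t ∷ τ)) + (rdetTerm′ (suc t ∷ zero ∷ map suc τ)
                                        + ∑ rdetTerm′ (map (suc t ∷_) (laterInsertions zero (map suc τ))))
        ≈⟨ +-cong (rdetTerm′-diagonal (t ∷ τ)) (+-cong (rdetTerm′-subdiagonal t τ)
                  (rdetTerm′-later t τ (≡.trans (cong ℕ.pred len) (length-tabulate {n = k} _)))) ⟩
      M 0 0 * rdetTerm minor (t ∷ τ) + (- rdetTerm folded (t ∷ τ) + 0#)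
        ≈⟨ +-congˡ (+-identityʳ _) ⟩
      M 0 0 * rdetTerm minor (t ∷ τ) - rdetTerm folded (t ∷ τ) ∎

    -- Every permutation of 0,1,…,k+1 is obtained by inserting the column 0 into a permutation of
    -- 1,…,k+1; inserting it in row 0 gives the minor, in row 1 the folded matrix, lower rows nothing.
    det-expand : det (suc (suc k)) M ≈
                 M 0 0 * det (suc k) (shift M) - det (suc k) (withFirstRow (φ ∘ M 0 ∘ suc) (shift M))
    det-expand = begin
      det (suc (suc k)) M
        ≡⟨ rdet-≡-∑ _ M̂ ⟩
      ∑ (rdetTerm M̂) (perms (allFin (suc (suc k))))
        ≡⟨ cong (λ rs → ∑ (λ σ → signed (oddInversions σ) (entryProduct M̂ rs σ)) (perms rs))
                (allFin-suc (suc k)) ⟩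
      ∑ rdetTerm′ (concatMap (insertions zero) (perms (map suc rows)))
        ≡⟨ cong (λ P → ∑ rdetTerm′ (concatMap (insertions zero) P)) (perms-map suc rows) ⟩
      ∑ rdetTerm′ (concatMap (insertions zero) (map (map suc) (perms rows)))
        ≈⟨ ∑-concatMap rdetTerm′ (insertions zero) (map (map suc) (perms rows)) ⟩
      ∑ (λ τ → ∑ rdetTerm′ (insertions zero τ)) (map (map suc) (perms rows))
        ≡⟨ ∑-map _ (map suc) (perms rows) ⟩
      ∑ (λ τ → ∑ rdetTerm′ (insertions zero (map suc τ))) (perms rows)
        ≈⟨ ∑-congᴬ (All.map (λ {τ} → insertions-∑ τ) (length-perms rows)) ⟩
      ∑ (λ τ → M 0 0 * rdetTerm minor τ - rdetTerm folded τ) (perms rows)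
        ≈⟨ ∑-- _ _ (perms rows) ⟩
      ∑ (λ τ → M 0 0 * rdetTerm minor τ) (perms rows) - ∑ (rdetTerm folded) (perms rows)
        ≈⟨ +-congʳ (sym (*-∑ (M 0 0) (rdetTerm minor) (perms rows))) ⟩
      M 0 0 * ∑ (rdetTerm minor) (perms rows) - ∑ (rdetTerm folded) (perms rows)
        ≡⟨ cong₂ (λ x y → M 0 0 * x - y) (≡.sym (rdet-≡-∑ _ minor)) (≡.sym (rdet-≡-∑ _ folded)) ⟩
      M 0 0 * det (suc k) (shift M) - det (suc k) (withFirstRow (φ ∘ M 0 ∘ suc) (shift M)) ∎

  open FirstColumnExpansion public using (det-expand)

  det-1 : (M : ℕ → ℕ → X) → det 1 M ≈ M 0 0
  det-1 M = trans (+-identityʳ _) (*-identityʳ _)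

commutativeRing⇒nonAssociativeRing : ∀ {c ℓ} → CommutativeRing c ℓ → NonAssociativeRing c ℓ
commutativeRing⇒nonAssociativeRing R = record
  { isNonAssociativeRing = record
    { +-isAbelianGroup = +-isAbelianGroup
    ; *-cong           = *-cong
    ; *-identity       = *-identity
    ; distrib          = distrib
    ; zero             = CommutativeRing.zero R
    }
  }
  where open CommutativeRing R hiding (zero)

module NSymAlgebra {c ℓ} (R : CommutativeRing c ℓ) where
  open CommutativeRing R renaming (Carrier to K) hiding (zero)
  open NSymDefs R
  open RowDeterminant (commutativeRing⇒nonAssociativeRing R) using (∑-cong; ∑-zeroᴬ; ∑-+; *-∑; ∑-map)
  open import Algebra.Properties.CommutativeSemigroup *-commutativeSemigroup using (x∙yz≈y∙xz)
  open import Relation.Binary.Reasoning.Setoid setoid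

  ⊗-cong : ∀ {f f′ g g′} → f ≋ f′ → g ≋ g′ → (f ⊗ g) ≋ (f′ ⊗ g′)
  ⊗-cong f≋f′ g≋g′ J = ∑-cong (λ (J₁ , J₂) → *-cong (f≋f′ J₁) (g≋g′ J₂)) (splits J)

  ⊗-zeroˡ : ∀ f → (𝟘 ⊗ f) ≋ 𝟘
  ⊗-zeroˡ f J = ∑-zeroᴬ (All.universal (λ _ → zeroˡ _) (splits J))

  ⊗-zeroʳ : ∀ f → (f ⊗ 𝟘) ≋ 𝟘
  ⊗-zeroʳ f J = ∑-zeroᴬ (All.universal (λ _ → zeroʳ _) (splits J))

  ⊗-distribˡ : ∀ f g h → (f ⊗ (g ⊕ h)) ≋ ((f ⊗ g) ⊕ (f ⊗ h))
  ⊗-distribˡ f g h J = trans (∑-cong (λ _ → distribˡ _ _ _) (splits J)) (∑-+ _ _ (splits J))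

  ⊗-distribʳ : ∀ f g h → ((g ⊕ h) ⊗ f) ≋ ((g ⊗ f) ⊕ (h ⊗ f))
  ⊗-distribʳ f g h J = trans (∑-cong (λ _ → distribʳ _ _ _) (splits J)) (∑-+ _ _ (splits J))

  ⊗-identityˡ : ∀ f → (𝟙 ⊗ f) ≋ f
  ⊗-identityˡ f []      = trans (+-identityʳ _) (*-identityˡ _)
  ⊗-identityˡ f (a ∷ J) =
    trans (+-cong (*-identityˡ _) (∑-zeroᴬ (All.map⁺ (All.universal (λ _ → zeroˡ _) (splits J)))))
          (+-identityʳ _)

  ⊗-identityʳ : ∀ f → (f ⊗ 𝟙) ≋ f
  ⊗-identityʳ f []      = trans (+-identityʳ _) (*-identityʳ _)
  ⊗-identityʳ f (a ∷ J) = begin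
    f [] * 0# + _           ≈⟨ +-cong (zeroʳ _) (reflexive (∑-map _ _ (splits J))) ⟩
    0# + (f′ ⊗ 𝟙) J         ≈⟨ +-identityˡ _ ⟩
    (f′ ⊗ 𝟙) J              ≈⟨ ⊗-identityʳ f′ J ⟩
    f (a ∷ J)               ∎
    where
    f′ : NSym
    f′ J = f (a ∷ J)

  -- ⊗ is associative as well, but the argument never needs it.
  nonAssociativeRing : NonAssociativeRing c ℓ
  nonAssociativeRing = record
    { Carrier = NSym
    ; _≈_ = _≋_
    ; _+_ = _⊕_
    ; _*_ = _⊗_
    ; -_ = ⊖_
    ; 0# = 𝟘
    ; 1# = 𝟙
    ; isNonAssociativeRing = record
      { +-isAbelianGroup = Pointwise.isAbelianGroup (List ℕ) +-isAbelianGroup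
      ; *-cong           = ⊗-cong
      ; *-identity       = ⊗-identityˡ , ⊗-identityʳ
      ; distrib          = ⊗-distribˡ , ⊗-distribʳ
      ; zero             = ⊗-zeroˡ , ⊗-zeroʳ
      }
    }

  ·-cong : ∀ {k k′ f f′} → k ≈ k′ → f ≋ f′ → (k · f) ≋ (k′ · f′)
  ·-cong k≈k′ f≋f′ J = *-cong k≈k′ (f≋f′ J)

  ·-zero : ∀ {k} f → k ≈ 0# → (k · f) ≋ 𝟘
  ·-zero f k≈0 J = trans (*-congʳ k≈0) (zeroˡ _)

  ·-assoc : ∀ k l f → (k · (l · f)) ≋ ((k * l) · f)
  ·-assoc k l f J = sym (*-assoc k l (f J))

  ·-⊗ : ∀ k f g → ((k · f) ⊗ g) ≋ (k · (f ⊗ g))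
  ·-⊗ k f g J = trans (∑-cong (λ _ → *-assoc _ _ _) (splits J)) (sym (*-∑ k _ (splits J)))

  ⊗-· : ∀ k f g → (f ⊗ (k · g)) ≋ (k · (f ⊗ g))
  ⊗-· k f g J = trans (∑-cong (λ _ → x∙yz≈y∙xz _ _ _) (splits J)) (sym (*-∑ k _ (splits J)))

module _ {c ℓ} (R : Ring c ℓ) where
  open Ring R
  open import Algebra.Properties.Ring R using (x[y-z]≈xy-xz; [y-z]x≈yx-zx)
  open import Relation.Binary.Reasoning.Setoid setoid

  [x-y]+[y-z]≈x-z : ∀ x y z → (x - y) + (y - z) ≈ x - z
  [x-y]+[y-z]≈x-z x y z = begin
    (x - y) + (y - z)   ≈⟨ +-assoc x (- y) (y - z) ⟩
    x + (- y + (y - z)) ≈⟨ +-congˡ (sym (+-assoc (- y) y (- z))) ⟩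
    x + ((- y + y) - z) ≈⟨ +-congˡ (+-congʳ (-‿inverseˡ y)) ⟩
    x + (0# - z)        ≈⟨ +-congˡ (+-identityˡ (- z)) ⟩
    x - z               ∎

  x[y-z]+[x-w]z≈xy-wz : ∀ x y z w → x * (y - z) + (x - w) * z ≈ x * y - w * z
  x[y-z]+[x-w]z≈xy-wz x y z w = begin
    x * (y - z) + (x - w) * z         ≈⟨ +-cong (x[y-z]≈xy-xz x y z) ([y-z]x≈yx-zx z x w) ⟩
    (x * y - x * z) + (x * z - w * z) ≈⟨ [x-y]+[y-z]≈x-z (x * y) (x * z) (w * z) ⟩
    x * y - w * z                     ∎

module HessenbergExpansion {c ℓ} (R : CommutativeRing c ℓ) where
  open CommutativeRing R renaming (Carrier to K) hiding (zero)
  open NSymDefs R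
  open NSymAlgebra R
  module K = RowDeterminant (commutativeRing⇒nonAssociativeRing R)
  module N where
    open NonAssociativeRing nonAssociativeRing public hiding (zero)
    open RowDeterminant nonAssociativeRing public
    open import Relation.Binary.Reasoning.Setoid (NonAssociativeRing.setoid nonAssociativeRing) public
  open import Algebra.Properties.Ring ring using ([y-z]x≈yx-zx)
  open import Algebra.Properties.CommutativeSemigroup *-commutativeSemigroup using (x∙yz≈y∙xz)
  open import Relation.Binary.Reasoning.Setoid setoid

  Hessenberg : (ℕ → ℕ → K) → Set ℓ
  Hessenberg V = ∀ i j → suc j < i → V i j ≈ 0#

  Hessenberg-shift : ∀ {V} → Hessenberg V → Hessenberg (shift V)
  Hessenberg-shift hess i j (s≤s j+1<i) = hess (suc i) (suc j) (s≤s (s≤s j+1<i))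

  hEntry : (ℕ → ℕ → K) → ℕ → ℕ → NSym
  hEntry V i j = V i j · S (suc j ∸ i)

  hMatrix : ℕ → (ℕ → K) → (ℕ → ℕ → K) → ℕ → ℕ → NSym
  hMatrix m u V = withFirstRow (λ j → u j · S (m ℕ.+ suc j)) (hEntry V)

  foldedRow : (ℕ → K) → (ℕ → ℕ → K) → ℕ → K
  foldedRow u V j = V 1 0 * u (suc j)

  hMatrix-expand : ∀ k m u V → Hessenberg V →
    N.det (suc (suc k)) (hMatrix m u V) ≋
      (((u 0 · S (m ℕ.+ 1)) ⊗ N.det (suc k) (hMatrix 0 (V 1 ∘ suc) (shift V)))
       ⊕ (⊖ N.det (suc k) (hMatrix (suc m) (foldedRow u V) (shift V))))
  hMatrix-expand k m u V hess = N.trans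
    (N.det-expand k (hMatrix m u V) (V 1 0 ·_) vanish absorb)
    (N.+-cong (N.*-congˡ (N.det-cong (suc k) minor)) (N.-‿cong (N.det-cong (suc k) folded)))
    where
    vanish : ∀ i → hMatrix m u V (suc (suc i)) 0 ≋ 𝟘
    vanish i = ·-zero _ (hess (suc (suc i)) 0 (s≤s (s≤s z≤n)))
    absorb : ∀ f g → (f ⊗ ((V 1 0 · 𝟙) ⊗ g)) ≋ ((V 1 0 · f) ⊗ g)
    absorb f g = N.trans (N.*-congˡ (N.trans (·-⊗ (V 1 0) 𝟙 g) (·-cong refl (N.*-identityˡ g))))
                         (N.trans (⊗-· (V 1 0) f g) (N.sym (·-⊗ (V 1 0) f g)))
    minor : ∀ i j → shift (hMatrix m u V) i j ≋ hMatrix 0 (V 1 ∘ suc) (shift V) i j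
    minor zero    j = N.refl
    minor (suc i) j = N.refl
    folded : ∀ i j → withFirstRow ((V 1 0 ·_) ∘ hMatrix m u V 0 ∘ suc) (shift (hMatrix m u V)) i j ≋
                     hMatrix (suc m) (foldedRow u V) (shift V) i j
    folded zero    j = N.trans (·-assoc (V 1 0) (u (suc j)) _)
                               (N.reflexive (cong (λ n → foldedRow u V j · S n) (+-suc m (suc j))))
    folded (suc i) j = N.refl

  firstRowDet : (ℕ → K) → (ℕ → ℕ → K) → ℕ → K
  firstRowDet u V n = K.det n (withFirstRow u V)

  firstRowDet-expand : ∀ k u V → Hessenberg V →
    firstRowDet u V (suc (suc k)) ≈
      u 0 * firstRowDet (V 1 ∘ suc) (shift V) (suc k) - firstRowDet (foldedRow u V) (shift V) (suc k)
  firstRowDet-expand k u V hess = trans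
    (K.det-expand k (withFirstRow u V) (V 1 0 *_) (λ i → hess (suc (suc i)) 0 (s≤s (s≤s z≤n)))
                  (λ x y → trans (x∙yz≈y∙xz x (V 1 0) y) (sym (*-assoc (V 1 0) x y))))
    (+-cong (*-congˡ (K.det-cong (suc k) minor)) (-‿cong (K.det-cong (suc k) folded)))
    where
    minor : ∀ i j → shift (withFirstRow u V) i j ≈ withFirstRow (V 1 ∘ suc) (shift V) i j
    minor zero    j = refl
    minor (suc i) j = refl
    folded : ∀ i j → withFirstRow ((V 1 0 *_) ∘ u ∘ suc) (shift (withFirstRow u V)) i j ≈
                     withFirstRow (foldedRow u V) (shift V) i j
    folded zero    j = refl
    folded (suc i) j = refl

  blockCoefficient : (ℕ → K) → (ℕ → ℕ → K) → List ℕ → K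
  blockCoefficient u V []      = 1#
  blockCoefficient u V (i ∷ I) = firstRowDet u V i * blockProd V i I

  blockProd-suc : ∀ V o I → blockProd V (suc o) I ≡ blockProd (shift V) o I
  blockProd-suc V o []      = ≡.refl
  blockProd-suc V o (k ∷ I) = cong (_ *_) (blockProd-suc V (o ℕ.+ k) I)

  blockProd≈blockCoefficient : ∀ V I → blockProd V 0 I ≈ blockCoefficient (V 0) V I
  blockProd≈blockCoefficient V []      = refl
  blockProd≈blockCoefficient V (i ∷ I) =
    *-congʳ (K.det-cong i {V} {withFirstRow (V 0) V} λ { zero j → refl ; (suc _) j → refl })

  blockCoefficient-one : ∀ u V I →
    blockCoefficient u V (1 ∷ I) ≈ u 0 * blockCoefficient (V 1 ∘ suc) (shift V) I
  blockCoefficient-one u V I = *-cong (K.det-1 (withFirstRow u V))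
    (trans (reflexive (blockProd-suc V 0 I)) (blockProd≈blockCoefficient (shift V) I))

  blockCoefficient-suc : ∀ u V i I → Hessenberg V →
    blockCoefficient u V (suc (suc i) ∷ I) ≈
      u 0 * blockCoefficient (V 1 ∘ suc) (shift V) (suc i ∷ I)
        - blockCoefficient (foldedRow u V) (shift V) (suc i ∷ I)
  blockCoefficient-suc u V i I hess = begin
    firstRowDet u V (suc (suc i)) * blockProd V (suc (suc i)) I
      ≈⟨ *-cong (firstRowDet-expand i u V hess) (reflexive (blockProd-suc V (suc i) I)) ⟩
    (u 0 * d₁ - d₂) * b
      ≈⟨ [y-z]x≈yx-zx b (u 0 * d₁) d₂ ⟩
    u 0 * d₁ * b - d₂ * b
      ≈⟨ +-congʳ (*-assoc (u 0) d₁ b) ⟩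
    u 0 * (d₁ * b) - d₂ * b ∎
    where
    d₁ = firstRowDet (V 1 ∘ suc) (shift V) (suc i)
    d₂ = firstRowDet (foldedRow u V) (shift V) (suc i)
    b  = blockProd (shift V) (suc i) I

  raiseHead : ℕ → List ℕ → List ℕ
  raiseHead m []      = []
  raiseHead m (a ∷ J) = m ℕ.+ a ∷ J

  raisedTerm : ℕ → List ℕ × Bool → NSym
  raisedTerm m (J , odd) = N.signed odd (Sprod (raiseHead m J))

  raisedRibbon : ℕ → List ℕ → NSym
  raisedRibbon m I = N.∑ (raisedTerm m) (coarsenings I)

  raisedRibbon-zero : ∀ I → raisedRibbon 0 I ≋ Rib I
  raisedRibbon-zero I = N.∑-cong
    (λ { ([] , true)    → N.refl ; ([] , false)    → N.refl
       ; (_ ∷ _ , true) → N.refl ; (_ ∷ _ , false) → N.refl })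
    (coarsenings I)

  raisedTerm-suc : ∀ m a J p → raisedTerm m (suc a ∷ J , p) ≡ raisedTerm (suc m) (a ∷ J , p)
  raisedTerm-suc m a J p = cong (λ n → N.signed p (Sprod (n ∷ J))) (+-suc m a)

  raisedTerm-one : ∀ m a J p →
    (raisedTerm m (1 ∷ a ∷ J , p) ⊕ (raisedTerm m (suc a ∷ J , not p) ⊕ 𝟘)) ≋
    ((S (m ℕ.+ 1) ⊗ raisedTerm 0 (a ∷ J , p)) ⊕ (⊖ raisedTerm (suc m) (a ∷ J , p)))
  raisedTerm-one m a J p = N.+-cong (N.signed-*ʳ p (S (m ℕ.+ 1)) (Sprod (a ∷ J)))
    (N.trans (N.+-identityʳ _) (N.trans (N.signed-not p _) (N.-‿cong (N.reflexive (raisedTerm-suc m a J p)))))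

  coarsenings-suc : ∀ b I → coarsenings (suc b ∷ I) ≡ map (map₁ incHead) (coarsenings (b ∷ I))
  coarsenings-suc b I = ≡.trans
    (concatMap-cong (λ { ([] , _) → ≡.refl ; (_ ∷ _ , _) → ≡.refl }) (coarsenings I))
    (≡.sym (map-concatMap (map₁ incHead) _ (coarsenings I)))

  coarsenings-nonEmpty : ∀ b I → All (NonEmpty ∘ proj₁) (coarsenings (b ∷ I))
  coarsenings-nonEmpty b I = All.concat⁺ (All.map⁺ (All.universal
    (λ { ([] , _) → nonEmpty ∷ [] ; (_ ∷ _ , _) → nonEmpty ∷ nonEmpty ∷ [] }) (coarsenings I)))

  raisedRibbon-suc : ∀ m b I → raisedRibbon m (suc b ∷ I) ≋ raisedRibbon (suc m) (b ∷ I)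
  raisedRibbon-suc m b I = N.trans
    (N.reflexive (≡.trans (cong (N.∑ (raisedTerm m)) (coarsenings-suc b I))
                          (N.∑-map _ _ (coarsenings (b ∷ I)))))
    (N.∑-cong (λ { ([] , _) → N.refl ; (a ∷ J , p) → N.reflexive (raisedTerm-suc m a J p) })
              (coarsenings (b ∷ I)))

  raisedRibbon-one : ∀ m b I →
    raisedRibbon m (1 ∷ b ∷ I) ≋
      ((S (m ℕ.+ 1) ⊗ raisedRibbon 0 (b ∷ I)) ⊕ (⊖ raisedRibbon (suc m) (b ∷ I)))
  raisedRibbon-one m b I = N.trans (N.∑-concatMap (raisedTerm m) _ C)
    (N.trans (N.∑-congᴬ (All.map (λ { {a ∷ J , p} nonEmpty → raisedTerm-one m a J p })
                                 (coarsenings-nonEmpty b I)))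
             (N.trans (N.∑-- _ _ C) (N.+-congʳ (N.sym (N.*-∑ (S (m ℕ.+ 1)) (raisedTerm 0) C)))))
    where C = coarsenings (b ∷ I)

  ribbonTerm : ℕ → (ℕ → K) → (ℕ → ℕ → K) → List ℕ → NSym
  ribbonTerm m u V I = blockCoefficient u V I · raisedRibbon m I

  ribbonExpansion : ℕ → (ℕ → K) → (ℕ → ℕ → K) → ℕ → NSym
  ribbonExpansion m u V n = N.∑ (ribbonTerm m u V) (compositions n)

  ribbonTerm-pair : ∀ m u V → Hessenberg V → ∀ i I →
    (ribbonTerm m u V (1 ∷ suc i ∷ I) ⊕ ribbonTerm m u V (suc (suc i) ∷ I)) ≋
      (((u 0 · S (m ℕ.+ 1)) ⊗ ribbonTerm 0 (V 1 ∘ suc) (shift V) (suc i ∷ I))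
       ⊕ (⊖ ribbonTerm (suc m) (foldedRow u V) (shift V) (suc i ∷ I)))
  ribbonTerm-pair m u V hess i I J = begin
    ribbonTerm m u V (1 ∷ suc i ∷ I) J + ribbonTerm m u V (suc (suc i) ∷ I) J
      ≈⟨ +-cong (·-cong (blockCoefficient-one u V (suc i ∷ I)) (raisedRibbon-one m (suc i) I) J)
                (·-cong (blockCoefficient-suc u V i I hess) (raisedRibbon-suc m (suc i) I) J) ⟩
    a * (s J - r J) + (a - c′) * r J
      ≈⟨ x[y-z]+[x-w]z≈xy-wz ring a (s J) (r J) c′ ⟩
    a * s J - c′ * r J
      ≈⟨ +-congʳ (sym (first J)) ⟩
    ((u 0 · S (m ℕ.+ 1)) ⊗ ribbonTerm 0 (V 1 ∘ suc) (shift V) (suc i ∷ I)) J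
      - ribbonTerm (suc m) (foldedRow u V) (shift V) (suc i ∷ I) J ∎
    where
    c₁ = blockCoefficient (V 1 ∘ suc) (shift V) (suc i ∷ I)
    c′ = blockCoefficient (foldedRow u V) (shift V) (suc i ∷ I)
    a  = u 0 * c₁
    s  = S (m ℕ.+ 1) ⊗ raisedRibbon 0 (suc i ∷ I)
    r  = raisedRibbon (suc m) (suc i ∷ I)
    first : ((u 0 · S (m ℕ.+ 1)) ⊗ (c₁ · raisedRibbon 0 (suc i ∷ I))) ≋ (a · s)
    first = N.trans (·-⊗ (u 0) (S (m ℕ.+ 1)) _)
              (N.trans (·-cong refl (⊗-· c₁ (S (m ℕ.+ 1)) _)) (·-assoc (u 0) c₁ _))

  ribbonExpansion-expand : ∀ k m u V → Hessenberg V →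
    ribbonExpansion m u V (suc (suc k)) ≋
      (((u 0 · S (m ℕ.+ 1)) ⊗ ribbonExpansion 0 (V 1 ∘ suc) (shift V) (suc k))
       ⊕ (⊖ ribbonExpansion (suc m) (foldedRow u V) (shift V) (suc k)))
  ribbonExpansion-expand k m u V hess = N.begin
    N.∑ F (map (1 ∷_) C ++ map incHead C)
      N.≈⟨ N.∑-++ F (map (1 ∷_) C) (map incHead C) ⟩
    (N.∑ F (map (1 ∷_) C) ⊕ N.∑ F (map incHead C))
      N.≡⟨ cong₂ _⊕_ (N.∑-map F (1 ∷_) C) (N.∑-map F incHead C) ⟩
    (N.∑ (λ I → F (1 ∷ I)) C ⊕ N.∑ (λ I → F (incHead I)) C)
      N.≈⟨ N.sym (N.∑-+ (λ I → F (1 ∷ I)) (λ I → F (incHead I)) C) ⟩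
    N.∑ (λ I → F (1 ∷ I) ⊕ F (incHead I)) C
      N.≈⟨ N.∑-congᴬ (All.map (λ { {suc i ∷ I} positiveHead → ribbonTerm-pair m u V hess i I })
                              (compositions-positiveHead k)) ⟩
    N.∑ (λ I → ((u 0 · S (m ℕ.+ 1)) ⊗ F₁ I) ⊕ (⊖ F′ I)) C
      N.≈⟨ N.∑-- _ F′ C ⟩
    (N.∑ (λ I → (u 0 · S (m ℕ.+ 1)) ⊗ F₁ I) C ⊕ (⊖ N.∑ F′ C))
      N.≈⟨ N.+-congʳ (N.sym (N.*-∑ (u 0 · S (m ℕ.+ 1)) F₁ C)) ⟩
    (((u 0 · S (m ℕ.+ 1)) ⊗ N.∑ F₁ C) ⊕ (⊖ N.∑ F′ C)) N.∎
    where
    C  = compositions (suc k)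
    F  = ribbonTerm m u V
    F₁ = ribbonTerm 0 (V 1 ∘ suc) (shift V)
    F′ = ribbonTerm (suc m) (foldedRow u V) (shift V)

  hMatrix-det≋ribbonExpansion : ∀ n m u V → Hessenberg V →
                                N.det n (hMatrix m u V) ≋ ribbonExpansion m u V n
  hMatrix-det≋ribbonExpansion zero          m u V hess J = sym (trans (+-identityʳ _) (*-identityˡ _))
  hMatrix-det≋ribbonExpansion (suc zero)    m u V hess = N.trans (N.det-1 (hMatrix m u V)) (N.sym
    (N.trans (N.+-identityʳ _) (·-cong (trans (*-identityʳ _) (K.det-1 (withFirstRow u V)))
                                       (N.trans (N.+-identityʳ _) (N.*-identityʳ _)))))
  hMatrix-det≋ribbonExpansion (suc (suc k)) m u V hess = N.trans (hMatrix-expand k m u V hess)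
    (N.trans (N.+-cong (N.*-congˡ (hMatrix-det≋ribbonExpansion (suc k) 0 (V 1 ∘ suc) (shift V) hess′))
                       (N.-‿cong (hMatrix-det≋ribbonExpansion (suc k) (suc m) (foldedRow u V) (shift V) hess′)))
             (N.sym (ribbonExpansion-expand k m u V hess)))
    where hess′ = Hessenberg-shift hess

  extend-toℕ : ∀ n w (i j : Fin n) → extend n w (toℕ i) (toℕ j) ≈ w i j
  extend-toℕ n w i j with toℕ i ℕ.<? n | toℕ j ℕ.<? n
  ... | yes p | yes q = reflexive (cong₂ w (fromℕ<-toℕ i p) (fromℕ<-toℕ j q))
  ... | yes _ | no ¬q = ⊥-elim (¬q (toℕ<n j))
  ... | no ¬p | _     = ⊥-elim (¬p (toℕ<n i))

  extend-Hessenberg : ∀ n w → AlmostTriangular n w → Hessenberg (extend n w)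
  extend-Hessenberg n w almost i j j+1<i with i ℕ.<? n | j ℕ.<? n
  ... | yes p | yes q = almost (fromℕ< p) (fromℕ< q)
                          (≡.subst₂ _<_ (cong suc (≡.sym (toℕ-fromℕ< q))) (≡.sym (toℕ-fromℕ< p)) j+1<i)
  ... | yes _ | no _  = refl
  ... | no _  | _     = refl

  H'entry≋hEntry : ∀ n w → AlmostTriangular n w →
                   ∀ i j → H'entry n w i j ≋ hEntry (extend n w) (toℕ i) (toℕ j)
  H'entry≋hEntry n w almost i j with toℕ i ℕ.≤? suc (toℕ j)
  ... | yes _  = ·-cong (sym (extend-toℕ n w i j)) N.refl
  ... | no i≰ = N.sym (·-zero _ (trans (extend-toℕ n w i j) (almost i j (≰⇒> i≰))))

mainTheorem8 : {c ℓ : Level} (R : CommutativeRing c ℓ) →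
    let open NSymDefs R in
    (n : ℕ) (W : Fin n → Fin n → CommutativeRing.Carrier R) → AlmostTriangular n W →
    H' n W ≋ sumN (map (λ I → W_ n W I · Rib I) (compositions n))
mainTheorem8 R n W almost = begin
  H' n W
    ≈⟨ N.rdet-cong n (λ i j → N.trans (H'entry≋hEntry n W almost i j)
                                      (hEntry≋hMatrix (toℕ i) (toℕ j))) ⟩
  N.det n (hMatrix 0 (V 0) V)
    ≈⟨ hMatrix-det≋ribbonExpansion n 0 (V 0) V (extend-Hessenberg n W almost) ⟩
  ribbonExpansion 0 (V 0) V n
    ≈⟨ N.∑-cong (λ I → ·-cong (sym (blockProd≈blockCoefficient V I)) (raisedRibbon-zero I))
                (compositions n) ⟩
  sumN (map (λ I → W_ n W I · Rib I) (compositions n)) ∎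
  where
  open NSymDefs R
  open NSymAlgebra R
  open HessenbergExpansion R
  open import Relation.Binary.Reasoning.Setoid N.setoid
  open CommutativeRing R using (sym)
  V = extend n W
  hEntry≋hMatrix : ∀ i j → hEntry V i j ≋ hMatrix 0 (V 0) V i j
  hEntry≋hMatrix ℕ.zero    j = N.refl
  hEntry≋hMatrix (ℕ.suc i) j = N.refl
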